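{- Let $p,q$ be integers with $\Delta=p^2-4q\neq 0$. Then for all $n\geq 4$, $$U_{n}^{(2)}=pU_{n-1}^{(2)}-pqU_{n-3}^{(2)}+q^{2}U_{n-4}^{(2)}\quad\text{and}\quad V_{n}^{(2)}=pV_{n-1}^{(2)}-pqV_{n-3}^{(2)}+q^{2}V_{n-4}^{(2)}.$$
   Context: For integers $p,q$, let $\Delta=p^2-4q$, $\alpha=\frac{p+\sqrt{\Delta}}{2}$, $\beta=\frac{p-\sqrt{\Delta}}{2}$, and $U_n=\frac{\alpha^n-\beta^n}{\alpha-\beta}$, $V_n=\alpha^n+\beta^n$ (so $U_0=0,U_1=1$, $V_0=2,V_1=p$, and both satisfy $W_n=pW_{n-1}-qW_{n-2}$). For $n=2m+r$ with $m\geq0$, $r\in\{0,1\}$, define $U_n^{(2)}=\frac{1}{(\alpha-\beta)^2}(\alpha^{m+1}-\beta^{m+1})^{r}(\alpha^{m}-\beta^{m})^{2-r}$ and $V_n^{(2)}=(\alpha^{m+1}+\beta^{m+1})^{r}(\alpha^{m}+\beta^{m})^{2-r}$; equivalently $U_{2m}^{(2)}=U_m^2$, $U_{2m+1}^{(2)}=U_mU_{m+1}$, $V_{2m}^{(2)}=V_m^2$, $V_{2m+1}^{(2)}=V_mV_{m+1}$. -}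

module Defs where

open import Data.Nat using (ℕ; zero; suc; ⌊_/2⌋)
open import Data.Integer using (ℤ; _+_; _-_; _*_; +_)

U : ℤ → ℤ → ℕ → ℤ
U p q zero = + 0
U p q (suc zero) = + 1
U p q (suc (suc n)) = p * U p q (suc n) - q * U p q n

V : ℤ → ℤ → ℕ → ℤ
V p q zero = + 2
V p q (suc zero) = p
V p q (suc (suc n)) = p * V p q (suc n) - q * V p q n

data Parity : Set where
  even odd : Parity

parity : ℕ → Parity
parity zero = even
parity (suc zero) = odd
parity (suc (suc n)) = parity n

-- For n = 2m + r (m = ⌊n/2⌋):
-- W2 n = W_{m+1}^r * W_m^(2-r), i.e. W_m^2 if n even, W_m W_{m+1} if n odd.
sq2 : (ℕ → ℤ) → ℕ → ℤ
sq2 W n with parity n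
... | even = W ⌊ n /2⌋ * W ⌊ n /2⌋
... | odd  = W ⌊ n /2⌋ * W (suc ⌊ n /2⌋)

U2 : ℤ → ℤ → ℕ → ℤ
U2 p q = sq2 (U p q)

V2 : ℤ → ℤ → ℕ → ℤ
V2 p q = sq2 (V p q)

-- Squaring commutes with shifting, sq2 W (n + 2) = sq2 (W ∘ suc) n, and a shifted Lucas
-- sequence satisfies the same recurrence. So by induction the four-term recurrence reduces to
-- n = 4 and n = 5, which are polynomial identities in W₀ and W₁.
module Submission where

open import Defs
open import Data.Nat using (ℕ; zero; suc) renaming (_+_ to _+ℕ_)
open import Data.Integer using (ℤ; _+_; _-_; _*_; +_)
open import Data.Integer.Tactic.RingSolver using (solve-∀)
open import Data.Product using (_×_; _,_)
open import Function using (_∘_)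
open import Relation.Binary.PropositionalEquality using (_≡_; refl)
open import Relation.Nullary using (¬_)

IsLucasSequence : ℤ → ℤ → (ℕ → ℤ) → Set
IsLucasSequence p q W = ∀ n → W (suc (suc n)) ≡ p * W (suc n) - q * W n

U-isLucasSequence : ∀ p q → IsLucasSequence p q (U p q)
U-isLucasSequence p q n = refl

V-isLucasSequence : ∀ p q → IsLucasSequence p q (V p q)
V-isLucasSequence p q n = refl

IsLucasSequence-shift : ∀ p q W → IsLucasSequence p q W → IsLucasSequence p q (W ∘ suc)
IsLucasSequence-shift p q W rec = rec ∘ suc

sq2-suc-suc : (W : ℕ → ℤ) (n : ℕ) → sq2 W (suc (suc n)) ≡ sq2 (W ∘ suc) n
sq2-suc-suc W n with parity n
... | even = refl
... | odd  = refl

Sq2Recurrence : ℤ → ℤ → (ℕ → ℤ) → ℕ → Set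
Sq2Recurrence p q W k =
  sq2 W (k +ℕ 4) ≡ p * sq2 W (k +ℕ 3) - p * q * sq2 W (k +ℕ 1) + q * q * sq2 W k

Sq2Recurrence-suc-suc : ∀ p q W k →
  Sq2Recurrence p q (W ∘ suc) k → Sq2Recurrence p q W (suc (suc k))
Sq2Recurrence-suc-suc p q W k eq
  rewrite sq2-suc-suc W (k +ℕ 4) | sq2-suc-suc W (k +ℕ 3)
        | sq2-suc-suc W (k +ℕ 1) | sq2-suc-suc W k = eq

sq2-recurrence-base-even : ∀ p q a b →
  (p * a - q * b) * (p * a - q * b)
  ≡ p * (a * (p * a - q * b)) - p * q * (b * a) + q * q * (b * b)
sq2-recurrence-base-even = solve-∀

sq2-recurrence-base-odd : ∀ p q a b →
  (p * a - q * b) * (p * (p * a - q * b) - q * a)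
  ≡ p * ((p * a - q * b) * (p * a - q * b)) - p * q * (a * a) + q * q * (b * a)
sq2-recurrence-base-odd = solve-∀

sq2-recurrence : ∀ p q {W} → IsLucasSequence p q W → ∀ k → Sq2Recurrence p q W k
sq2-recurrence p q {W} rec zero rewrite rec 0 = sq2-recurrence-base-even p q (W 1) (W 0)
sq2-recurrence p q {W} rec (suc zero) rewrite rec 1 | rec 0 =
  sq2-recurrence-base-odd p q (W 1) (W 0)
sq2-recurrence p q {W} rec (suc (suc k)) =
  Sq2Recurrence-suc-suc p q W k (sq2-recurrence p q (IsLucasSequence-shift p q W rec) k)

theorem4 : (p q : ℤ) → ¬ (p * p - + 4 * q ≡ + 0) → (k : ℕ) →
    (U2 p q (k +ℕ 4) ≡ p * U2 p q (k +ℕ 3) - p * q * U2 p q (k +ℕ 1) + q * q * U2 p q k)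
    × (V2 p q (k +ℕ 4) ≡ p * V2 p q (k +ℕ 3) - p * q * V2 p q (k +ℕ 1) + q * q * V2 p q k)
theorem4 p q _ k =
  sq2-recurrence p q (U-isLucasSequence p q) k , sq2-recurrence p q (V-isLucasSequence p q) k
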